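{- Let $p$ and $q$ be positive integers. A hypergraph $\mathcal H$ is $(p,q)$-Helly if and only if $\varPhi_q(\mathcal H)$ is $p$-Helly.
   Context: A hypergraph $\mathcal H$ is a pair $(X,\mathcal E)$ with $X=V(\mathcal H)$ a finite set and $\mathcal E$ a finite family of nonempty subsets of $X$ (edges) whose union is $X$. The core of a family of sets is the intersection of its members. A family is $(p,q)$-intersecting if every nonempty subfamily of at most $p$ members has core of cardinality at least $q$; a hypergraph is $(p,q)$-Helly if every nonempty $(p,q)$-intersecting subfamily of its edge family has core of cardinality at least $q$; $p$-Helly means $(p,1)$-Helly. For a set $S$, $\varphi_q(S)$ denotes the set of $q$-subsets of $S$. $\varPhi_q(\mathcal H)$ is the hypergraph whose vertices are the $q$-subsets of $V(\mathcal H)$ contained in some edge of $\mathcal H$ and whose edges are the sets $\varphi_q(E)$ as $E$ ranges over the edges of $\mathcal H$ of cardinality at least $q$. -}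

module Defs where

open import Level using (0ℓ)
open import Data.Nat using (ℕ; _≤_; _≤?_)
open import Data.Fin using (Fin)
open import Data.Fin.Subset using (Subset; _∈_; _⊆_; ∣_∣; Nonempty)
open import Data.List using (List; length; lookup; map; filter)
open import Data.List.Relation.Unary.All using (All)
open import Data.List.Relation.Unary.Any using (Any)
open import Data.Product using (Σ; _×_; ∃)
open import Function.Definitions using (Injective)
open import Relation.Binary.PropositionalEquality using (_≡_)
open import Relation.Unary using (Pred)

-- General notions for a family of sets over an ambient type V.
-- Sets are predicates on V; a family is a list of sets (repetitions allowed),
-- a subfamily is a set of indices into the list.

Family : Set → Set₁
Family V = List (Pred V 0ℓ)

SubFam : {V : Set} → Family V → Set
SubFam F = Subset (length F)

Core : {V : Set} (F : Family V) → SubFam F → Pred V 0ℓ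
Core F I x = ∀ i → i ∈ I → lookup F i x

AtLeast : {V : Set} → ℕ → Pred V 0ℓ → Set
AtLeast {V} q S = Σ (Fin q → V) λ f → Injective _≡_ _≡_ f × (∀ i → S (f i))

IntersectingSub : {V : Set} → ℕ → ℕ → (F : Family V) → SubFam F → Set
IntersectingSub p q F J =
  ∀ (I : SubFam F) → I ⊆ J → Nonempty I → ∣ I ∣ ≤ p → AtLeast q (Core F I)

PQHelly : {V : Set} → ℕ → ℕ → Family V → Set
PQHelly p q F =
  ∀ (J : SubFam F) → Nonempty J → IntersectingSub p q F J → AtLeast q (Core F J)

PHelly : {V : Set} → ℕ → Family V → Set
PHelly p F = PQHelly p 1 F

-- Hypergraphs on the vertex set Fin n (any finite set, up to relabelling)

record Hypergraph (n : ℕ) : Set where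
  field
    edges    : List (Subset n)
    nonempty : All Nonempty edges
    covers   : ∀ (x : Fin n) → Any (x ∈_) edges

open Hypergraph public

EdgeFam : {n : ℕ} → Hypergraph n → Family (Fin n)
EdgeFam H = map (λ E x → x ∈ E) (edges H)

φ : {n : ℕ} → ℕ → Subset n → Pred (Subset n) 0ℓ
φ q E S = (∣ S ∣ ≡ q) × (S ⊆ E)

ΦVertices : {n : ℕ} → ℕ → Hypergraph n → Pred (Subset n) 0ℓ
ΦVertices q H S = (∣ S ∣ ≡ q) × Any (S ⊆_) (edges H)

ΦEdges : {n : ℕ} → ℕ → Hypergraph n → Family (Subset n)
ΦEdges q H = map (φ q) (filter (λ E → q ≤? ∣ E ∣) (edges H))

{-# OPTIONS --safe #-}
-- A subfamily of the edges is the same thing as a sublist of the edge list, and on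
-- sublists both sides of the equivalence speak about the same lists of edges: a
-- nonempty list of edges has at least q common vertices iff some q-set lies in all of
-- them, i.e. iff the corresponding members of Φ_q(H) have a common vertex.  The only
-- difference is that Φ_q(H) forgets the edges with fewer than q vertices; these never
-- occur in a (p,q)-intersecting family when p ≥ 1, since such a family contains each of
-- its members as a subfamily of size 1.
module Submission where

open import Defs
open import Data.Nat using (ℕ; NonZero)
open import Function.Bundles using (_⇔_)

open import Level using (0ℓ)
open import Data.Nat using (zero; suc; _≤_; _<_; _≤?_; z≤n; s≤s; >-nonZero⁻¹)
open import Data.Fin using (Fin; zero; suc)
open import Data.Fin.Properties using (suc-injective; injective⇒≤)
open import Data.Fin.Subset using (Subset; _∈_; _⊆_; ∣_∣; Nonempty; inside; outside; ⊤; ⊥; ⋂)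
open import Data.Fin.Subset.Properties
  using (∈⊤; x∈p∩q⁺; x∈p∩q⁻; drop-∷-⊆; s⊆s; out⊆; ⊥⊆; ⊆⊤; ∣⊥∣≡0)
open import Data.Bool using (Bool)
open import Data.Vec using ([]; _∷_; here; there)
open import Data.List using (List; []; _∷_; length; map; filter)
open import Data.List.Properties using (filter-all)
open import Data.List.Membership.Propositional using () renaming (_∈_ to _∈ₗ_)
open import Data.List.Relation.Unary.All as All using (All; []; _∷_)
open import Data.List.Relation.Binary.Sublist.Propositional using ([]; _∷_; _∷ʳ_; ⊆-trans; from∈)
  renaming (_⊆_ to _⊑_)
open import Data.List.Relation.Binary.Sublist.Propositional.Properties using (filter-⊆; filter⁺)
open import Data.Product using (∃; _×_; _,_; proj₁; proj₂)
open import Function.Bundles using (mk⇔; Equivalence)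
open import Function.Properties.Equivalence using () renaming (trans to ⇔-trans; sym to ⇔-sym)
open import Relation.Binary.PropositionalEquality using (_≡_; refl; sym; cong; subst)
open import Relation.Nullary using (Dec; contradiction)
open import Relation.Unary using (Pred)

open Equivalence using (to; from)

private variable
  n k : ℕ
  V : Set

atLeast-mono : {P Q : Pred V 0ℓ} → (∀ {x} → P x → Q x) → AtLeast k P → AtLeast k Q
atLeast-mono P⇒Q (f , f-inj , f∈P) = f , f-inj , λ i → P⇒Q (f∈P i)

atLeast-cong : {P Q : Pred V 0ℓ} → (∀ x → P x ⇔ Q x) → AtLeast k P ⇔ AtLeast k Q
atLeast-cong P⇔Q = mk⇔ (atLeast-mono λ {x} → to (P⇔Q x)) (atLeast-mono λ {x} → from (P⇔Q x))

atLeast1⇔∃ : {P : Pred V 0ℓ} → AtLeast 1 P ⇔ ∃ P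
atLeast1⇔∃ = mk⇔ (λ (f , _ , f∈P) → f zero , f∈P zero)
                  (λ (x , x∈P) → (λ _ → x) , (λ {i} {j} _ → Fin1-unique i j) , λ _ → x∈P)
  where
  Fin1-unique : (i j : Fin 1) → i ≡ j
  Fin1-unique zero zero = refl

rank : (C : Subset n) {x : Fin n} → x ∈ C → Fin ∣ C ∣
rank (inside ∷ C) here = zero
rank (inside ∷ C) (there x∈C) = suc (rank C x∈C)
rank (outside ∷ C) (there x∈C) = rank C x∈C

rank-injective : (C : Subset n) {x y : Fin n} (x∈C : x ∈ C) (y∈C : y ∈ C) →
                 rank C x∈C ≡ rank C y∈C → x ≡ y
rank-injective (inside ∷ C) here here _ = refl
rank-injective (inside ∷ C) (there x∈C) (there y∈C) eq =
  cong suc (rank-injective C x∈C y∈C (suc-injective eq))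
rank-injective (outside ∷ C) (there x∈C) (there y∈C) eq = cong suc (rank-injective C x∈C y∈C eq)

atLeast⇒≤∣∣ : (C : Subset n) → AtLeast k (_∈ C) → k ≤ ∣ C ∣
atLeast⇒≤∣∣ C (f , f-inj , f∈C) =
  injective⇒≤ {f = λ i → rank C (f∈C i)} (λ eq → f-inj (rank-injective C (f∈C _) (f∈C _) eq))

enumerate : (C : Subset n) → Fin ∣ C ∣ → Fin n
enumerate (inside ∷ C) zero = zero
enumerate (inside ∷ C) (suc i) = suc (enumerate C i)
enumerate (outside ∷ C) i = suc (enumerate C i)

enumerate-∈ : (C : Subset n) (i : Fin ∣ C ∣) → enumerate C i ∈ C
enumerate-∈ (inside ∷ C) zero = here
enumerate-∈ (inside ∷ C) (suc i) = there (enumerate-∈ C i)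
enumerate-∈ (outside ∷ C) i = there (enumerate-∈ C i)

enumerate-injective : (C : Subset n) {i j : Fin ∣ C ∣} → enumerate C i ≡ enumerate C j → i ≡ j
enumerate-injective (inside ∷ C) {zero} {zero} _ = refl
enumerate-injective (inside ∷ C) {suc i} {suc j} eq =
  cong suc (enumerate-injective C (suc-injective eq))
enumerate-injective (outside ∷ C) eq = enumerate-injective C (suc-injective eq)

atLeast-∣∣ : (C : Subset n) → AtLeast ∣ C ∣ (_∈ C)
atLeast-∣∣ C = enumerate C , enumerate-injective C , enumerate-∈ C

subsetOfSize : (C : Subset n) → k ≤ ∣ C ∣ → ∃ λ S → S ⊆ C × ∣ S ∣ ≡ k
subsetOfSize {n} {zero} C _ = ⊥ , ⊥⊆ , ∣⊥∣≡0 n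
subsetOfSize {k = suc k} (inside ∷ C) (s≤s k≤∣C∣) =
  let S , S⊆C , ∣S∣≡k = subsetOfSize C k≤∣C∣ in inside ∷ S , s⊆s S⊆C , cong suc ∣S∣≡k
subsetOfSize {k = suc k} (outside ∷ C) k≤∣C∣ =
  let S , S⊆C , ∣S∣≡k = subsetOfSize C k≤∣C∣ in outside ∷ S , s⊆s S⊆C , ∣S∣≡k

∈⋂⁺ : (Ms : List (Subset n)) {x : Fin n} → All (x ∈_) Ms → x ∈ ⋂ Ms
∈⋂⁺ [] [] = ∈⊤
∈⋂⁺ (E ∷ Ms) (x∈E ∷ x∈Ms) = x∈p∩q⁺ (x∈E , ∈⋂⁺ Ms x∈Ms)

⊆⋂⁻ : (Ms : List (Subset n)) {S : Subset n} → S ⊆ ⋂ Ms → All (S ⊆_) Ms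
⊆⋂⁻ [] _ = []
⊆⋂⁻ (E ∷ Ms) {S} S⊆⋂ = (λ x∈S → proj₁ (split x∈S)) ∷ ⊆⋂⁻ Ms (λ x∈S → proj₂ (split x∈S))
  where
  split : ∀ {x} → x ∈ S → x ∈ E × x ∈ ⋂ Ms
  split x∈S = x∈p∩q⁻ E (⋂ Ms) (S⊆⋂ x∈S)

module _ {A : Set} (f : A → Pred V 0ℓ) where

  SublistCore : List A → Pred V 0ℓ
  SublistCore Ms x = All (λ E → f E x) Ms

  SublistIntersecting : ℕ → ℕ → List A → Set
  SublistIntersecting p q Ms =
    ∀ {Ns} → Ns ⊑ Ms → 0 < length Ns → length Ns ≤ p → AtLeast q (SublistCore Ns)

  SublistHelly : ℕ → ℕ → List A → Set
  SublistHelly p q L =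
    ∀ {Ms} → Ms ⊑ L → 0 < length Ms → SublistIntersecting p q Ms → AtLeast q (SublistCore Ms)

  select : (L : List A) → SubFam (map f L) → List A
  select [] [] = []
  select (E ∷ L) (inside ∷ I) = E ∷ select L I
  select (E ∷ L) (outside ∷ I) = select L I

  length-select : (L : List A) (I : SubFam (map f L)) → length (select L I) ≡ ∣ I ∣
  length-select [] [] = refl
  length-select (E ∷ L) (inside ∷ I) = cong suc (length-select L I)
  length-select (E ∷ L) (outside ∷ I) = length-select L I

  nonempty⇔0<length-select : (L : List A) (I : SubFam (map f L)) →
                             Nonempty I ⇔ 0 < length (select L I)
  nonempty⇔0<length-select L I = mk⇔ (nonempty⇒ L I) (⇒nonempty L I)
    where
    nonempty⇒ : (L : List A) (I : SubFam (map f L)) → Nonempty I → 0 < length (select L I)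
    nonempty⇒ (E ∷ L) (inside ∷ I) _ = s≤s z≤n
    nonempty⇒ (E ∷ L) (outside ∷ I) (suc i , there i∈I) = nonempty⇒ L I (i , i∈I)
    ⇒nonempty : (L : List A) (I : SubFam (map f L)) → 0 < length (select L I) → Nonempty I
    ⇒nonempty [] [] ()
    ⇒nonempty (E ∷ L) (inside ∷ I) _ = zero , here
    ⇒nonempty (E ∷ L) (outside ∷ I) 0<len =
      let i , i∈I = ⇒nonempty L I 0<len in suc i , there i∈I

  Core-∷⁻ : {E : A} {L : List A} {b : Bool} {I : SubFam (map f L)} {x : V} →
            Core (map f (E ∷ L)) (b ∷ I) x → Core (map f L) I x
  Core-∷⁻ x∈core i i∈I = x∈core (suc i) (there i∈I)

  Core⇔SublistCore : (L : List A) (I : SubFam (map f L)) (x : V) →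
                     Core (map f L) I x ⇔ SublistCore (select L I) x
  Core⇔SublistCore L I x = mk⇔ (Core⇒ L I) (⇒Core L I)
    where
    Core⇒ : (L : List A) (I : SubFam (map f L)) {x : V} →
            Core (map f L) I x → SublistCore (select L I) x
    Core⇒ [] [] _ = []
    Core⇒ (E ∷ L) (inside ∷ I) x∈core = x∈core zero here ∷ Core⇒ L I (Core-∷⁻ x∈core)
    Core⇒ (E ∷ L) (outside ∷ I) x∈core = Core⇒ L I (Core-∷⁻ x∈core)
    ⇒Core : (L : List A) (I : SubFam (map f L)) {x : V} →
            SublistCore (select L I) x → Core (map f L) I x
    ⇒Core (E ∷ L) (inside ∷ I) (x∈E ∷ _) zero here = x∈E
    ⇒Core (E ∷ L) (inside ∷ I) (_ ∷ x∈core) (suc i) (there i∈I) = ⇒Core L I x∈core i i∈I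
    ⇒Core (E ∷ L) (outside ∷ I) x∈core (suc i) (there i∈I) = ⇒Core L I x∈core i i∈I

  select-mono : (L : List A) {I J : SubFam (map f L)} → I ⊆ J → select L I ⊑ select L J
  select-mono [] {[]} {[]} _ = []
  select-mono (E ∷ L) {inside ∷ I} {inside ∷ J} I⊆J = refl ∷ select-mono L (drop-∷-⊆ I⊆J)
  select-mono (E ∷ L) {inside ∷ I} {outside ∷ J} I⊆J = contradiction (I⊆J here) λ ()
  select-mono (E ∷ L) {outside ∷ I} {inside ∷ J} I⊆J = E ∷ʳ select-mono L (drop-∷-⊆ I⊆J)
  select-mono (E ∷ L) {outside ∷ I} {outside ∷ J} I⊆J = select-mono L (drop-∷-⊆ I⊆J)

  select-⊤ : (L : List A) → select L ⊤ ≡ L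
  select-⊤ [] = refl
  select-⊤ (E ∷ L) = cong (E ∷_) (select-⊤ L)

  select-⊑ : (L : List A) (I : SubFam (map f L)) → select L I ⊑ L
  select-⊑ L I = subst (select L I ⊑_) (select-⊤ L) (select-mono L ⊆⊤)

  ⊑-select⇒ : (L : List A) (J : SubFam (map f L)) {Ns : List A} → Ns ⊑ select L J →
              ∃ λ I → I ⊆ J × select L I ≡ Ns
  ⊑-select⇒ [] [] [] = [] , (λ ()) , refl
  ⊑-select⇒ (E ∷ L) (inside ∷ J) (.E ∷ʳ Ns⊑J) =
    let I , I⊆J , eq = ⊑-select⇒ L J Ns⊑J in outside ∷ I , out⊆ I⊆J , eq
  ⊑-select⇒ (E ∷ L) (inside ∷ J) (refl ∷ Ns⊑J) =
    let I , I⊆J , eq = ⊑-select⇒ L J Ns⊑J in inside ∷ I , s⊆s I⊆J , cong (E ∷_) eq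
  ⊑-select⇒ (E ∷ L) (outside ∷ J) Ns⊑J =
    let I , I⊆J , eq = ⊑-select⇒ L J Ns⊑J in outside ∷ I , out⊆ I⊆J , eq

  IntersectingSub⇔SublistIntersecting : (p q : ℕ) (L : List A) (J : SubFam (map f L)) →
    IntersectingSub p q (map f L) J ⇔ SublistIntersecting p q (select L J)
  IntersectingSub⇔SublistIntersecting p q L J = mk⇔ forth back
    where
    forth : IntersectingSub p q (map f L) J → SublistIntersecting p q (select L J)
    forth int Ns⊑J 0<∣Ns∣ ∣Ns∣≤p with ⊑-select⇒ L J Ns⊑J
    ... | I , I⊆J , refl =
      to (atLeast-cong (Core⇔SublistCore L I))
         (int I I⊆J (from (nonempty⇔0<length-select L I) 0<∣Ns∣)
                    (subst (_≤ p) (length-select L I) ∣Ns∣≤p))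
    back : SublistIntersecting p q (select L J) → IntersectingSub p q (map f L) J
    back int I I⊆J I≢∅ ∣I∣≤p =
      from (atLeast-cong (Core⇔SublistCore L I))
           (int (select-mono L I⊆J) (to (nonempty⇔0<length-select L I) I≢∅)
                (subst (_≤ p) (sym (length-select L I)) ∣I∣≤p))

  PQHelly⇔SublistHelly : (p q : ℕ) (L : List A) → PQHelly p q (map f L) ⇔ SublistHelly p q L
  PQHelly⇔SublistHelly p q L = mk⇔ forth back
    where
    forth : PQHelly p q (map f L) → SublistHelly p q L
    forth helly Ms⊑L 0<∣Ms∣ int with ⊑-select⇒ L ⊤ (subst (_ ⊑_) (sym (select-⊤ L)) Ms⊑L)
    ... | J , _ , refl =
      to (atLeast-cong (Core⇔SublistCore L J))
         (helly J (from (nonempty⇔0<length-select L J) 0<∣Ms∣)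
                  (from (IntersectingSub⇔SublistIntersecting p q L J) int))
    back : SublistHelly p q L → PQHelly p q (map f L)
    back helly J J≢∅ int =
      from (atLeast-cong (Core⇔SublistCore L J))
           (helly (select-⊑ L J) (to (nonempty⇔0<length-select L J) J≢∅)
                  (to (IntersectingSub⇔SublistIntersecting p q L J) int))

_∋_ : Subset n → Pred (Fin n) 0ℓ
E ∋ x = x ∈ E

q-core⇔Φ-core : (q : ℕ) {Ms : List (Subset n)} → 0 < length Ms →
  AtLeast q (SublistCore _∋_ Ms) ⇔ AtLeast 1 (SublistCore (φ q) Ms)
q-core⇔Φ-core q {E ∷ Ms} _ = ⇔-trans (mk⇔ forth back) (⇔-sym atLeast1⇔∃)
  where
  forth : AtLeast q (SublistCore _∋_ (E ∷ Ms)) → ∃ (SublistCore (φ q) (E ∷ Ms))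
  forth core = let S , S⊆⋂ , ∣S∣≡q = subsetOfSize (⋂ (E ∷ Ms)) q≤∣⋂∣
               in S , All.map (∣S∣≡q ,_) (⊆⋂⁻ (E ∷ Ms) S⊆⋂)
    where
    q≤∣⋂∣ : q ≤ ∣ ⋂ (E ∷ Ms) ∣
    q≤∣⋂∣ = atLeast⇒≤∣∣ (⋂ (E ∷ Ms)) (atLeast-mono (λ {x} → ∈⋂⁺ (E ∷ Ms) {x}) core)
  back : ∃ (SublistCore (φ q) (E ∷ Ms)) → AtLeast q (SublistCore _∋_ (E ∷ Ms))
  back (S , S∈φ@((∣S∣≡q , _) ∷ _)) =
    atLeast-mono (λ {x} x∈S → All.map {Q = _∋ x} (λ (_ , S⊆E) → S⊆E x∈S) S∈φ)
                 (subst (λ k → AtLeast k (_∈ S)) ∣S∣≡q (atLeast-∣∣ S))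

SublistIntersecting⇔Φ : (p q : ℕ) (Ms : List (Subset n)) →
  SublistIntersecting _∋_ p q Ms ⇔ SublistIntersecting (φ q) p 1 Ms
SublistIntersecting⇔Φ p q Ms =
  mk⇔ (λ int {_} Ns⊑Ms 0<∣Ns∣ ∣Ns∣≤p → to (q-core⇔Φ-core q 0<∣Ns∣) (int Ns⊑Ms 0<∣Ns∣ ∣Ns∣≤p))
      (λ int {_} Ns⊑Ms 0<∣Ns∣ ∣Ns∣≤p → from (q-core⇔Φ-core q 0<∣Ns∣) (int Ns⊑Ms 0<∣Ns∣ ∣Ns∣≤p))

intersecting⇒big : {p q : ℕ} → 1 ≤ p → {Ms : List (Subset n)} →
  SublistIntersecting _∋_ p q Ms → All (λ E → q ≤ ∣ E ∣) Ms
intersecting⇒big {q = q} 1≤p {Ms} int = All.tabulate big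
  where
  big : ∀ {E} → E ∈ₗ Ms → q ≤ ∣ E ∣
  big {E} E∈Ms = atLeast⇒≤∣∣ E (atLeast-mono (λ {x} → All.head {P = _∋ x}) [E]-core)
    where
    [E]-core : AtLeast q (SublistCore _∋_ (E ∷ []))
    [E]-core = int (from∈ E∈Ms) (s≤s z≤n) 1≤p

SublistHelly⇔Φ : (p q : ℕ) → 1 ≤ p → (L : List (Subset n)) →
  SublistHelly _∋_ p q L ⇔ SublistHelly (φ q) p 1 (filter (λ E → q ≤? ∣ E ∣) L)
SublistHelly⇔Φ p q 1≤p L = mk⇔ forth back
  where
  big? : (E : Subset _) → Dec (q ≤ ∣ E ∣)
  big? E = q ≤? ∣ E ∣
  forth : SublistHelly _∋_ p q L → SublistHelly (φ q) p 1 (filter big? L)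
  forth helly Ms⊑L 0<∣Ms∣ int =
    to (q-core⇔Φ-core q 0<∣Ms∣)
       (helly (⊆-trans Ms⊑L (filter-⊆ big? L)) 0<∣Ms∣ (from (SublistIntersecting⇔Φ p q _) int))
  back : SublistHelly (φ q) p 1 (filter big? L) → SublistHelly _∋_ p q L
  back helly {Ms} Ms⊑L 0<∣Ms∣ int =
    from (q-core⇔Φ-core q 0<∣Ms∣)
         (helly Ms⊑big 0<∣Ms∣ (to (SublistIntersecting⇔Φ p q _) int))
    where
    Ms⊑big : Ms ⊑ filter big? L
    Ms⊑big = subst (_⊑ filter big? L) (filter-all big? (intersecting⇒big 1≤p int))
                   (filter⁺ big? big? (λ { refl big → big }) Ms⊑L)

corollary2p6 : (p q : ℕ) → NonZero p → NonZero q → (n : ℕ) → (H : Hypergraph n) →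
    PQHelly p q (EdgeFam H) ⇔ PHelly p (ΦEdges q H)
corollary2p6 p q p≢0 _ n H =
  ⇔-trans (PQHelly⇔SublistHelly _∋_ p q L)
    (⇔-trans (SublistHelly⇔Φ p q (>-nonZero⁻¹ p {{p≢0}}) L)
             (⇔-sym (PQHelly⇔SublistHelly (φ q) p 1 (filter (λ E → q ≤? ∣ E ∣) L))))
  where
  L : List (Subset n)
  L = edges H
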